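{- Every tree $T$ on $n$ vertices contains (as a subgraph) a caterpillar on at least $\log_2 n$ vertices.
   Context: A caterpillar is a tree in which every vertex lies on, or is adjacent to, a single path (the spine). -}

module Defs where

open import Level using (0ℓ)
open import Data.Nat using (ℕ; _≤_; _^_)
open import Data.Fin using (Fin)
open import Data.List using (List; []; _∷_; _∷ʳ_; length)
open import Data.List.Relation.Unary.Linked using (Linked)
open import Data.List.Relation.Unary.Unique.Propositional using (Unique)
open import Data.List.Relation.Unary.Any using (Any)
open import Data.List.Membership.Propositional using (_∈_)
open import Data.Product using (Σ; ∃; _×_; _,_)
open import Data.Sum using (_⊎_)
open import Relation.Nullary using (¬_)
open import Relation.Binary.PropositionalEquality using (_≡_)
open import Function.Definitions using (Injective)

record Graph (n : ℕ) : Set₁ where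
  field
    Adj    : Fin n → Fin n → Set
    sym    : ∀ {u v} → Adj u v → Adj v u
    irrefl : ∀ {u} → ¬ Adj u u
open Graph public

module _ {n : ℕ} (G : Graph n) where

  IsPath : List (Fin n) → Set
  IsPath xs = (1 ≤ length xs) × Linked (Adj G) xs × Unique xs

  PathBetween : Fin n → Fin n → List (Fin n) → Set
  PathBetween u v rest = IsPath (u ∷ rest) × LastIs u rest v
    where
    LastIs : Fin n → List (Fin n) → Fin n → Set
    LastIs x [] y = x ≡ y
    LastIs _ (x ∷ xs) y = LastIs x xs y

  Connected : Set
  Connected = ∀ u v → ∃ λ rest → PathBetween u v rest

  IsCycle : Fin n → List (Fin n) → Set
  IsCycle u vs = (2 ≤ length vs) × Unique (u ∷ vs) × Linked (Adj G) ((u ∷ vs) ∷ʳ u)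

  Acyclic : Set
  Acyclic = ∀ u vs → ¬ IsCycle u vs

  IsTree : Set
  IsTree = Connected × Acyclic

  IsCaterpillar : Set
  IsCaterpillar = IsTree × ∃ λ spine → IsPath spine ×
                    (∀ v → v ∈ spine ⊎ Any (Adj G v) spine)

_⊆G_ : {m n : ℕ} → Graph m → Graph n → Set
_⊆G_ {m} {n} H G = ∃ λ (f : Fin m → Fin n) →
  Injective _≡_ _≡_ f × (∀ {u v} → Adj H u v → Adj G (f u) (f v))

-- Root the tree at r. The greedy caterpillar hanging from a vertex x consists of x, all its
-- children, and (recursively) the caterpillar hanging from the child h whose caterpillar is
-- largest; so if x has d children, its caterpillar has c(x) = d + c(h) vertices. By induction the
-- subtree of x has at most 1 + d · 2^c(h) ≤ 2^(d + c(h)) = 2^c(x) vertices, hence n ≤ 2^c(r).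
-- Acyclicity makes these vertices distinct, and the subgraph of T they induce is a caterpillar
-- whose spine is the heavy path r, h, ….
module Submission where

open import Defs
open import Data.Nat using (ℕ; zero; suc; _+_; _*_; _^_; _≤_; z≤n; s≤s)
import Data.Nat.Properties as ℕ
open import Data.Fin using (Fin)
import Data.Fin.Properties as Fin
open import Data.List using (List; []; _∷_; _++_; _∷ʳ_; length; lookup; map; filter; concatMap; allFin)
import Data.List.Properties as List
open import Data.List.Relation.Unary.Linked as Linked using (Linked; []; [-]; _∷_)
import Data.List.Relation.Unary.Linked.Properties as Linked
open import Data.List.Relation.Unary.Unique.Propositional using (Unique)
import Data.List.Relation.Unary.Unique.Propositional.Properties as Unique
open import Data.List.Relation.Unary.AllPairs using ([]; _∷_)
open import Data.List.Relation.Unary.All as All using (All; []; _∷_)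
open import Data.List.Relation.Unary.All.Properties as All using (¬Any⇒All¬)
open import Data.List.Relation.Unary.Any as Any using (Any; here; there)
import Data.List.Relation.Unary.Any.Properties as Any
open import Data.List.Membership.Propositional using (_∈_; _∉_; find; lose)
import Data.List.Membership.Propositional.Properties as ∈
open import Data.List.Relation.Binary.Disjoint.Propositional using (Disjoint)
open import Data.List.Relation.Binary.Subset.Propositional using (_⊆_)
open import Data.List.Extrema.Nat using (argmax; argmax-all; f[⊥]≤f[argmax]; f[xs]≤f[argmax])
open import Data.Product using (Σ; ∃; _×_; _,_; proj₁; proj₂)
open import Data.Sum using (_⊎_; inj₁; inj₂)
open import Function using (_∘_; case_of_)
open import Relation.Binary.Construct.Closure.ReflexiveTransitive as Star using (Star; ε; _◅_; _◅◅_)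
open import Relation.Nullary using (¬_; Dec; yes; no; contradiction)
open import Relation.Nullary.Decidable using (_×-dec_; ¬?)
open import Relation.Binary.PropositionalEquality as ≡ using (_≡_; refl; cong; subst)

module _ {A : Set} where

  unique-∷ : ∀ {x} {xs : List A} → x ∉ xs → Unique xs → Unique (x ∷ xs)
  unique-∷ {xs = xs} x∉xs xs! = ¬Any⇒All¬ xs x∉xs ∷ xs!

  unique-head : ∀ {x} {xs : List A} → Unique (x ∷ xs) → x ∉ xs
  unique-head (x≢xs ∷ _) x∈xs = All.lookup x≢xs x∈xs refl

  unique-++⁻ˡ : ∀ (xs : List A) {ys} → Unique (xs ++ ys) → Unique xs
  unique-++⁻ˡ []       _           = []
  unique-++⁻ˡ (x ∷ xs) (x≢ ∷ xs!) = All.++⁻ˡ xs x≢ ∷ unique-++⁻ˡ xs xs!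

  lookup-injective : ∀ {xs : List A} → Unique xs → ∀ {i j} → lookup xs i ≡ lookup xs j → i ≡ j
  lookup-injective {_ ∷ _} _           {Fin.zero}  {Fin.zero}  _  = refl
  lookup-injective {_ ∷ _} (x≢ ∷ _)   {Fin.zero}  {Fin.suc j} eq = contradiction eq (All.lookup x≢ (∈.∈-lookup j))
  lookup-injective {_ ∷ _} (x≢ ∷ _)   {Fin.suc i} {Fin.zero}  eq = contradiction (≡.sym eq) (All.lookup x≢ (∈.∈-lookup i))
  lookup-injective {_ ∷ _} (_ ∷ xs!)  {Fin.suc i} {Fin.suc j} eq = cong Fin.suc (lookup-injective xs! eq)

  module _ {R : A → A → Set} where

    linked-++⁻ˡ : ∀ (xs : List A) {ys} → Linked R (xs ++ ys) → Linked R xs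
    linked-++⁻ˡ []           _       = []
    linked-++⁻ˡ (_ ∷ [])     _       = [-]
    linked-++⁻ˡ (_ ∷ x ∷ xs) (r ∷ l) = r ∷ linked-++⁻ˡ (x ∷ xs) l

    linked-∷ʳ⁺ : ∀ (xs : List A) {x y} → Linked R (xs ∷ʳ x) → R x y → Linked R (xs ∷ʳ x ∷ʳ y)
    linked-∷ʳ⁺ []           _       r = r ∷ [-]
    linked-∷ʳ⁺ (_ ∷ [])     (r′ ∷ _) r = r′ ∷ r ∷ [-]
    linked-∷ʳ⁺ (_ ∷ z ∷ zs) (r′ ∷ l) r = r′ ∷ linked-∷ʳ⁺ (z ∷ zs) l r

    linked⇒walk : ∀ {x y xs} → Linked R (x ∷ xs) → y ∈ x ∷ xs → Star R x y
    linked⇒walk _       (here refl)       = ε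
    linked⇒walk (r ∷ l) (there y∈xs)      = r ◅ linked⇒walk l y∈xs
    linked⇒walk [-]     (there ())

length-∷ʳ≥1 : ∀ {A : Set} (xs : List A) {x} → 1 ≤ length (xs ∷ʳ x)
length-∷ʳ≥1 xs = subst (1 ≤_) (≡.sym (List.length-++ xs)) (ℕ.m≤n+m 1 (length xs))

length-concatMap≤ : ∀ {A B : Set} (f : A → List B) {b} xs → (∀ {x} → x ∈ xs → length (f x) ≤ b) →
                    length (concatMap f xs) ≤ length xs * b
length-concatMap≤ f []       _     = z≤n
length-concatMap≤ f (x ∷ xs) bound = ℕ.≤-trans (ℕ.≤-reflexive (List.length-++ (f x)))
  (ℕ.+-mono-≤ (bound (here refl)) (length-concatMap≤ f xs (bound ∘ there)))

module _ {n : ℕ} where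

  unique⇒length≤ : ∀ {xs : List (Fin n)} → Unique xs → length xs ≤ n
  unique⇒length≤ xs! = Fin.injective⇒≤ (lookup-injective xs!)

  covering⇒length≥ : ∀ {xs : List (Fin n)} → (∀ i → i ∈ xs) → n ≤ length xs
  covering⇒length≥ {xs} cover = Fin.injective⇒≤ index-injective
    where
    index-injective : ∀ {i j} → Any.index (cover i) ≡ Any.index (cover j) → i ≡ j
    index-injective {i} {j} eq =
      ≡.trans (Any.lookup-index (cover i)) (≡.trans (cong (lookup xs) eq) (≡.sym (Any.lookup-index (cover j))))

suc≤2^ : ∀ d → suc d ≤ 2 ^ d
suc≤2^ zero    = s≤s z≤n
suc≤2^ (suc d) = ℕ.+-mono-≤ (ℕ.m^n>0 2 d) (ℕ.≤-trans (suc≤2^ d) (ℕ.m≤m+n (2 ^ d) 0))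

suc[*2^]≤2^[+] : ∀ d m → suc (d * 2 ^ m) ≤ 2 ^ (d + m)
suc[*2^]≤2^[+] d m = begin
  suc (d * 2 ^ m)     ≤⟨ ℕ.+-monoˡ-≤ (d * 2 ^ m) (ℕ.m^n>0 2 m) ⟩
  suc d * 2 ^ m       ≤⟨ ℕ.*-monoˡ-≤ (2 ^ m) (suc≤2^ d) ⟩
  2 ^ d * 2 ^ m       ≡⟨ ℕ.^-distribˡ-+-* 2 d m ⟨
  2 ^ (d + m)         ∎
  where open ℕ.≤-Reasoning

module _ {n : ℕ} (G : Graph n) where

  open import Data.List.Membership.DecPropositional (Fin._≟_ {n}) using (_∈?_)

  path-∷ : ∀ {u x xs} → IsPath G (x ∷ xs) → Adj G u x → u ∉ x ∷ xs → IsPath G (u ∷ x ∷ xs)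
  path-∷ (_ , l , xs!) a u∉ = s≤s z≤n , a ∷ l , unique-∷ u∉ xs!

  path-tail : ∀ {x y ys} → IsPath G (x ∷ y ∷ ys) → IsPath G (y ∷ ys)
  path-tail (_ , l , _ ∷ ys!) = s≤s z≤n , Linked.tail l , ys!

  path-++-∷ : ∀ {y} V {v xs} → IsPath G (y ∷ V ++ v ∷ xs) → IsPath G (y ∷ (V ∷ʳ v) ++ xs)
  path-++-∷ {y} V {v} {xs} = subst (λ L → IsPath G (y ∷ L)) (≡.sym (List.++-assoc V (v ∷ []) xs))

  pathBetween-refl : ∀ {u} → PathBetween G u u []
  pathBetween-refl = (s≤s z≤n , [-] , [] ∷ []) , refl

  pathBetween-∷ : ∀ {u x v rest} → Adj G u x → u ∉ x ∷ rest → PathBetween G x v rest →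
                  PathBetween G u v (x ∷ rest)
  pathBetween-∷ a u∉ (p , last) = path-∷ p a u∉ , last

  pathBetween-tail : ∀ {u x v rest} → PathBetween G u v (x ∷ rest) → PathBetween G x v rest
  pathBetween-tail (p , last) = path-tail p , last

  pathBetween-end∈ : ∀ {u v} rest → PathBetween G u v rest → v ∈ u ∷ rest
  pathBetween-end∈ []         (_ , refl) = here refl
  pathBetween-end∈ (_ ∷ rest) pb         = there (pathBetween-end∈ rest (pathBetween-tail pb))

  pathBetween-suffix : ∀ {x u v} rest → PathBetween G x v rest → u ∈ x ∷ rest →
                       ∃ λ rest′ → PathBetween G u v rest′
  pathBetween-suffix rest       pb (here refl)  = rest , pb
  pathBetween-suffix (_ ∷ rest) pb (there u∈)   = pathBetween-suffix rest (pathBetween-tail pb) u∈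

  -- Loop erasure: prepend the next vertex, or cut back to its earlier occurrence.
  walk⇒path : ∀ {u v} → Star (Adj G) u v → ∃ λ rest → PathBetween G u v rest
  walk⇒path ε = [] , pathBetween-refl
  walk⇒path {u} (_◅_ {j = x} a w) with walk⇒path w
  ... | rest , pb with u ∈? x ∷ rest
  ...   | yes u∈ = pathBetween-suffix rest pb u∈
  ...   | no  u∉ = x ∷ rest , pathBetween-∷ a u∉ pb

  walks-from⇒connected : ∀ t → (∀ v → Star (Adj G) t v) → Connected G
  walks-from⇒connected t walk u v = walk⇒path (Star.reverse (sym G) (walk u) ◅◅ walk v)

  Dominating : List (Fin n) → Set
  Dominating S = ∀ v → v ∈ S ⊎ Any (Adj G v) S

  dominating-path⇒connected : ∀ {S} → IsPath G S → Dominating S → Connected G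
  dominating-path⇒connected {s ∷ _} (_ , l , _) dom = walks-from⇒connected s walk
    where
    walk : ∀ v → Star (Adj G) s v
    walk v with dom v
    ... | inj₁ v∈S = linked⇒walk l v∈S
    ... | inj₂ v~S with find v~S
    ...   | w , w∈S , v~w = linked⇒walk l w∈S ◅◅ (sym G v~w ◅ ε)

  acyclic∧dominating-path⇒caterpillar : Acyclic G → ∀ {S} → IsPath G S → Dominating S → IsCaterpillar G
  acyclic∧dominating-path⇒caterpillar acyclic p dom =
    (dominating-path⇒connected p dom , acyclic) , _ , p , dom

  acyclic⇒chordless : Acyclic G → ∀ {y x} as {bs} → IsPath G (y ∷ as ++ x ∷ bs) → 1 ≤ length as →
                      ¬ Adj G x y
  acyclic⇒chordless acyclic {y} {x} as {bs} (_ , l , ys!) 1≤as x~y =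
    acyclic y (as ∷ʳ x) (2≤length , unique-++⁻ˡ (y ∷ as ∷ʳ x) ys!′ , cycle)
    where
    split : (y ∷ as ∷ʳ x) ++ bs ≡ y ∷ as ++ x ∷ bs
    split = cong (y ∷_) (List.++-assoc as (x ∷ []) bs)
    ys!′ = subst Unique (≡.sym split) ys!
    cycle = linked-∷ʳ⁺ (y ∷ as) (linked-++⁻ˡ (y ∷ as ∷ʳ x) (subst (Linked (Adj G)) (≡.sym split) l)) x~y
    2≤length : 2 ≤ length (as ∷ʳ x)
    2≤length = subst (2 ≤_) (≡.sym (List.length-++ as)) (ℕ.+-monoˡ-≤ 1 1≤as)

  tree⇒Adj? : IsTree G → ∀ u v → Dec (Adj G u v)
  tree⇒Adj? (connected , acyclic) u v with connected u v
  ... | rest , pb with pathBetween-end∈ rest pb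
  ...   | here refl          = no (irrefl G)
  ...   | there (here refl)  = yes (Linked.head (proj₁ (proj₂ (proj₁ pb))))
  ...   | there (there v∈) with ∈.∈-∃++ v∈
  ...     | as , bs , refl  = no λ u~v → acyclic⇒chordless acyclic (_ ∷ as) (proj₁ pb) (s≤s z≤n) (sym G u~v)

module _ {n : ℕ} (G : Graph n) (K : List (Fin n)) where

  induced : Graph (length K)
  induced = record
    { Adj    = λ i j → Adj G (lookup K i) (lookup K j)
    ; sym    = sym G
    ; irrefl = irrefl G
    }

  indices : ∀ {S} → All (_∈ K) S → List (Fin (length K))
  indices []       = []
  indices (p ∷ ps) = Any.index p ∷ indices ps

  lookup-indices : ∀ {S} (ps : All (_∈ K) S) → map (lookup K) (indices ps) ≡ S
  lookup-indices []       = refl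
  lookup-indices (p ∷ ps) = ≡.cong₂ _∷_ (≡.sym (Any.lookup-index p)) (lookup-indices ps)

  module _ (K! : Unique K) where

    induced⊆G : induced ⊆G G
    induced⊆G = lookup K , lookup-injective K! , λ a → a

    induced-acyclic : Acyclic G → Acyclic induced
    induced-acyclic acyclic u vs (2≤vs , vs! , cycle) = acyclic (lookup K u) (map (lookup K) vs)
      ( subst (2 ≤_) (≡.sym (List.length-map (lookup K) vs)) 2≤vs
      , Unique.map⁺ (lookup-injective K!) vs!
      , subst (Linked (Adj G)) (List.map-++ (lookup K) (u ∷ vs) (u ∷ [])) (Linked.map⁺ cycle))

    induced-caterpillar : Acyclic G → ∀ {S} → IsPath G S → All (_∈ K) S →
                          (∀ {x} → x ∈ K → x ∈ S ⊎ Any (Adj G x) S) → IsCaterpillar induced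
    induced-caterpillar acyclic {S} (1≤S , l , S!) S⊆K dom =
      acyclic∧dominating-path⇒caterpillar induced (induced-acyclic acyclic) path dom′
      where
      S′ = indices S⊆K
      S≡ : S ≡ map (lookup K) S′
      S≡ = ≡.sym (lookup-indices S⊆K)
      path : IsPath induced S′
      path = subst (1 ≤_) (≡.trans (cong length S≡) (List.length-map (lookup K) S′)) 1≤S
           , Linked.map⁻ (subst (Linked (Adj G)) S≡ l)
           , Unique.map⁻ (subst Unique S≡ S!)
      dom′ : Dominating induced S′
      dom′ i with dom (∈.∈-lookup i)
      ... | inj₂ i~S = inj₂ (Any.map⁻ (subst (Any (Adj G (lookup K i))) S≡ i~S))
      ... | inj₁ i∈S with ∈.∈-map⁻ (lookup K) (subst (lookup K i ∈_) S≡ i∈S)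
      ...   | j , j∈S′ , i≡j = inj₁ (subst (_∈ S′) (≡.sym (lookup-injective K! i≡j)) j∈S′)

module RootedTree {n : ℕ} (T : Graph n) (Adj? : ∀ u v → Dec (Adj T u v)) where

  open import Data.List.Membership.DecPropositional (Fin._≟_ {n}) using (_∈?_)

  -- x ∷ π is the path from x back to the root.
  Child : Fin n → List (Fin n) → Fin n → Set
  Child x π c = Adj T x c × c ∉ x ∷ π

  child? : ∀ x π c → Dec (Child x π c)
  child? x π c = Adj? x c ×-dec ¬? (c ∈? x ∷ π)

  children : Fin n → List (Fin n) → List (Fin n)
  children x π = filter (child? x π) (allFin n)

  ∈-children⁺ : ∀ {x π c} → Child x π c → c ∈ children x π
  ∈-children⁺ {x} {π} {c} = ∈.∈-filter⁺ (child? x π) (∈.∈-allFin c)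

  children-child : ∀ x π → All (Child x π) (children x π)
  children-child x π = All.tabulate (proj₂ ∘ ∈.∈-filter⁻ (child? x π) {xs = allFin n})

  children-unique : ∀ x π → Unique (children x π)
  children-unique x π = Unique.filter⁺ (child? x π) (Unique.allFin⁺ n)

  child-path : ∀ {x π c} → IsPath T (x ∷ π) → Child x π c → IsPath T (c ∷ x ∷ π)
  child-path p (x~c , c∉) = path-∷ T p (sym T x~c) c∉

  -- The depth bound k only ensures termination: paths have at most n vertices, so k = n
  -- reaches every vertex.
  subtree : ℕ → Fin n → List (Fin n) → List (Fin n)
  subtree zero    x π = x ∷ []
  subtree (suc k) x π = x ∷ concatMap (λ c → subtree k c (x ∷ π)) (children x π)

  mutual
    weight : ℕ → List (Fin n) → Fin n → ℕ
    weight k π c = length (caterpillarBelow k c π)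

    caterpillarBelow : ℕ → Fin n → List (Fin n) → List (Fin n)
    caterpillarBelow zero    x π = []
    caterpillarBelow (suc k) x π with children x π
    ... | []     = []
    ... | c ∷ cs = c ∷ cs ++ caterpillarBelow k (heavyChild k x π c cs) (x ∷ π)

    heavyChild : ℕ → Fin n → List (Fin n) → Fin n → List (Fin n) → Fin n
    heavyChild k x π = argmax (weight k (x ∷ π))

  -- The heavy path below x, listed from its end back to the root.
  spine : ℕ → Fin n → List (Fin n) → List (Fin n)
  spine zero    x π = x ∷ π
  spine (suc k) x π with children x π
  ... | []     = x ∷ π
  ... | c ∷ cs = spine k (heavyChild k x π c cs) (x ∷ π)

  heavyChild∈ : ∀ k x π c cs → heavyChild k x π c cs ∈ c ∷ cs
  heavyChild∈ k x π c cs = argmax-all (weight k (x ∷ π)) (here refl) (All.tabulate there)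

  heavyChild-max : ∀ k x π {c cs d} → d ∈ c ∷ cs → weight k (x ∷ π) d ≤ weight k (x ∷ π) (heavyChild k x π c cs)
  heavyChild-max k x π {c} {cs} (here refl) = f[⊥]≤f[argmax] {f = weight k (x ∷ π)} c cs
  heavyChild-max k x π {c} {cs} (there d∈)  = All.lookup (f[xs]≤f[argmax] {f = weight k (x ∷ π)} c cs) d∈

  subtree-bound : ∀ k x π → length (subtree k x π) ≤ 2 ^ length (x ∷ caterpillarBelow k x π)
  subtree-bound zero    x π = s≤s z≤n
  subtree-bound (suc k) x π with children x π
  ... | []     = s≤s z≤n
  ... | c ∷ cs = begin
    suc (length (concatMap subtree′ (c ∷ cs)))   ≤⟨ s≤s (length-concatMap≤ subtree′ (c ∷ cs) child-bound) ⟩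
    suc (length (c ∷ cs) * 2 ^ length (h ∷ B))  ≤⟨ suc[*2^]≤2^[+] (length (c ∷ cs)) _ ⟩
    2 ^ (length (c ∷ cs) + length (h ∷ B))      ≡⟨ cong (2 ^_) length-eq ⟩
    2 ^ length (x ∷ c ∷ cs ++ B)                ∎
    where
    open ℕ.≤-Reasoning
    h = heavyChild k x π c cs
    B = caterpillarBelow k h (x ∷ π)
    subtree′ : Fin n → List (Fin n)
    subtree′ d = subtree k d (x ∷ π)
    child-bound : ∀ {d} → d ∈ c ∷ cs → length (subtree k d (x ∷ π)) ≤ 2 ^ length (h ∷ B)
    child-bound d∈ = ℕ.≤-trans (subtree-bound k _ (x ∷ π)) (ℕ.^-monoʳ-≤ 2 (s≤s (heavyChild-max k x π d∈)))
    length-eq : length (c ∷ cs) + length (h ∷ B) ≡ length (x ∷ c ∷ cs ++ B)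
    length-eq = ≡.trans (ℕ.+-suc (length (c ∷ cs)) (length B)) (cong suc (≡.sym (List.length-++ (c ∷ cs))))

  ∈-subtree : ∀ k {x π w} ρ → PathBetween T x w ρ → Disjoint ρ π → length ρ ≤ k → w ∈ subtree k x π
  ∈-subtree zero    []      (_ , refl) _ _ = here refl
  ∈-subtree (suc k) []      (_ , refl) _ _ = here refl
  ∈-subtree zero    (_ ∷ _) _          _ ()
  ∈-subtree (suc k) {x} {π} (c ∷ ρ) pb ρ∩π=∅ (s≤s ρ≤k) =
    there (∈.∈-concatMap⁺ (λ d → subtree k d (x ∷ π)) (lose (∈-children⁺ (x~c , c∉xπ))
      (∈-subtree k ρ (pathBetween-tail T pb) ρ∩xπ=∅ ρ≤k)))
    where
    x~c = Linked.head (proj₁ (proj₂ (proj₁ pb)))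
    x∉cρ = unique-head (proj₂ (proj₂ (proj₁ pb)))
    c∉xπ : c ∉ x ∷ π
    c∉xπ (here refl)  = x∉cρ (here refl)
    c∉xπ (there c∈π) = ρ∩π=∅ (here refl , c∈π)
    ρ∩xπ=∅ : Disjoint ρ (x ∷ π)
    ρ∩xπ=∅ (y∈ρ , here refl)  = x∉cρ (there y∈ρ)
    ρ∩xπ=∅ (y∈ρ , there y∈π) = ρ∩π=∅ (there y∈ρ , y∈π)

  ⊆-spine : ∀ k x π → x ∷ π ⊆ spine k x π
  ⊆-spine zero    x π = λ y∈ → y∈
  ⊆-spine (suc k) x π with children x π
  ... | []     = λ y∈ → y∈
  ... | c ∷ cs = ⊆-spine k _ (x ∷ π) ∘ there

  spine-path : ∀ k {x π} → IsPath T (x ∷ π) → IsPath T (spine k x π)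
  spine-path zero    p = p
  spine-path (suc k) {x} {π} p with children x π | children-child x π
  ... | []     | _   = p
  ... | c ∷ cs | chs = spine-path k (child-path p (All.lookup chs (heavyChild∈ k x π c cs)))

  ∈-spine⁻ : ∀ k x π {s} → s ∈ spine k x π → s ∈ x ∷ π ⊎ s ∈ caterpillarBelow k x π
  ∈-spine⁻ zero    x π s∈ = inj₁ s∈
  ∈-spine⁻ (suc k) x π s∈ with children x π
  ... | []     = inj₁ s∈
  ... | c ∷ cs with ∈-spine⁻ k (heavyChild k x π c cs) (x ∷ π) s∈
  ...   | inj₁ (here refl) = inj₂ (∈.∈-++⁺ˡ (heavyChild∈ k x π c cs))
  ...   | inj₁ (there s∈′) = inj₁ s∈′
  ...   | inj₂ s∈′         = inj₂ (∈.∈-++⁺ʳ (c ∷ cs) s∈′)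

  caterpillarBelow-dominated : ∀ k x π {y} → y ∈ caterpillarBelow k x π → Any (Adj T y) (spine k x π)
  caterpillarBelow-dominated (suc k) x π y∈ with children x π | children-child x π
  ... | c ∷ cs | chs with ∈.∈-++⁻ (c ∷ cs) y∈
  ...   | inj₁ y∈cs = lose (⊆-spine k _ (x ∷ π) (there (here refl))) (sym T (proj₁ (All.lookup chs y∈cs)))
  ...   | inj₂ y∈′  = caterpillarBelow-dominated k _ (x ∷ π) y∈′

  caterpillarBelow-descends : ∀ k {x π y} → IsPath T (x ∷ π) → y ∈ caterpillarBelow k x π → ∃ λ V → IsPath T (y ∷ V ++ x ∷ π)
  caterpillarBelow-descends (suc k) {x} {π} p y∈ with children x π | children-child x π
  ... | c ∷ cs | chs with ∈.∈-++⁻ (c ∷ cs) y∈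
  ...   | inj₁ y∈cs = [] , child-path p (All.lookup chs y∈cs)
  ...   | inj₂ y∈′ with caterpillarBelow-descends k (child-path p (All.lookup chs (heavyChild∈ k x π c cs))) y∈′
  ...     | V , q = V ∷ʳ heavyChild k x π c cs , path-++-∷ T V q

  caterpillarBelow-unique : Acyclic T → ∀ k {x π} → IsPath T (x ∷ π) → Unique (caterpillarBelow k x π)
  caterpillarBelow-unique acyclic zero    p = []
  caterpillarBelow-unique acyclic (suc k) {x} {π} p with children x π | children-child x π | children-unique x π
  ... | []     | _   | _   = []
  ... | c ∷ cs | chs | cs! = Unique.++⁺ cs! (caterpillarBelow-unique acyclic k h-path) disjoint
    where
    h = heavyChild k x π c cs
    h-path = child-path p (All.lookup chs (heavyChild∈ k x π c cs))
    disjoint : Disjoint (c ∷ cs) (caterpillarBelow k h (x ∷ π))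
    disjoint (y∈cs , y∈caterpillarBelow) with caterpillarBelow-descends k h-path y∈caterpillarBelow
    ... | V , q = acyclic⇒chordless T acyclic (V ∷ʳ h) (path-++-∷ T V q) (length-∷ʳ≥1 V) (proj₁ (All.lookup chs y∈cs))

  root-path : ∀ r → IsPath T (r ∷ [])
  root-path r = s≤s z≤n , [-] , [] ∷ []

  root-caterpillar-unique : Acyclic T → ∀ k r → Unique (r ∷ caterpillarBelow k r [])
  root-caterpillar-unique acyclic k r = unique-∷ r∉caterpillarBelow (caterpillarBelow-unique acyclic k (root-path r))
    where
    r∉caterpillarBelow : r ∉ caterpillarBelow k r []
    r∉caterpillarBelow r∈ with caterpillarBelow-descends k (root-path r) r∈
    ... | V , (_ , _ , r!) = unique-head r! (∈.∈-++⁺ʳ V (here refl))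

  spine⊆root-caterpillar : ∀ k r → All (_∈ r ∷ caterpillarBelow k r []) (spine k r [])
  spine⊆root-caterpillar k r = All.tabulate λ s∈ → case ∈-spine⁻ k r [] s∈ of λ where
    (inj₁ (here refl)) → here refl
    (inj₂ s∈caterpillarBelow)     → there s∈caterpillarBelow

  root-caterpillar-dominated : ∀ k r {x} → x ∈ r ∷ caterpillarBelow k r [] → x ∈ spine k r [] ⊎ Any (Adj T x) (spine k r [])
  root-caterpillar-dominated k r (here refl) = inj₁ (⊆-spine k r [] (here refl))
  root-caterpillar-dominated k r (there x∈)  = inj₂ (caterpillarBelow-dominated k r [] x∈)

  connected⇒∈-subtree : Connected T → ∀ r w → w ∈ subtree n r []
  connected⇒∈-subtree connected r w with connected r w
  ... | ρ , pb = ∈-subtree n ρ pb (λ { (_ , ()) }) (ℕ.<⇒≤ (unique⇒length≤ (proj₂ (proj₂ (proj₁ pb)))))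

proposition3p5 : (n : ℕ) (T : Graph n) → 1 ≤ n → IsTree T →
    Σ ℕ λ m → Σ (Graph m) λ C → IsCaterpillar C × (C ⊆G T) × n ≤ 2 ^ m
proposition3p5 zero    _ () _
proposition3p5 (suc n) T _ tree@(connected , acyclic) =
    length K
  , induced T K
  , induced-caterpillar T K K! acyclic (spine-path (suc n) (root-path r))
      (spine⊆root-caterpillar (suc n) r) (root-caterpillar-dominated (suc n) r)
  , induced⊆G T K K!
  , ℕ.≤-trans (covering⇒length≥ (connected⇒∈-subtree connected r)) (subtree-bound (suc n) r [])
  where
  open RootedTree T (tree⇒Adj? T tree)
  r = Fin.zero
  K = r ∷ caterpillarBelow (suc n) r []
  K! = root-caterpillar-unique acyclic (suc n) r
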